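{- Let $U=\{U_i\mid i\in\mathbb{N}\}$ be a semigroup and $A\subseteq\mathbb{N}$, and suppose there is a member $X$ of $U$ (i.e. $X=U_j$ for some $j$) such that $A-n\,\tilde\in\, U$ for each $n\in X$. Then $U\cup\{A\}$ is a semigroup.
   Context: $\mathbb{N}=\{0,1,2,\dots\}$. For $X\subseteq\mathbb{N}$ and $n\in\mathbb{N}$, $X-n:=\{m\mid m+n\in X\}$. For a countable sequence $U=\{U_i\mid i\in\mathbb{N}\}$ of subsets of $\mathbb{N}$ and a finite $F\subseteq\mathbb{N}$, $U_F:=\bigcap_{i\in F}U_i$. We write $X\,\tilde\in\, U$ if there is a finite $F\subseteq\mathbb{N}$ with $U_F\subseteq X$. $U$ satisfies the finite intersection property (fip) if $U_F$ is infinite for every finite $F\subseteq\mathbb{N}$. If $U,V$ satisfy fip, $X\,\tilde\in\, U+V$ means there is $Y\,\tilde\in\, V$ such that $X-n\,\tilde\in\, U$ for every $n\in Y$. $U$ is a semigroup if $U$ satisfies fip and every member $U_i$ of $U$ satisfies $U_i\,\tilde\in\, U+U$. $U\cup\{A\}$ denotes a sequence of subsets of $\mathbb{N}$ whose members are exactly the members of $U$ together with $A$. -}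

module Defs where

open import Level using (0ℓ)
open import Data.Nat using (ℕ; zero; suc; _+_; _≤_)
open import Data.List using (List; []; _∷_)
open import Data.Product using (Σ; ∃; _×_)
open import Relation.Unary using (Pred; _⊆_; _∩_; U)

Subset : Set₁
Subset = Pred ℕ 0ℓ

Seq : Set₁
Seq = ℕ → Subset

_⊖_ : Subset → ℕ → Subset
(X ⊖ n) m = X (m + n)

-- U_F := ⋂_{i ∈ F} U_i  (finite F given as a list; empty intersection = ℕ)
⋂ : Seq → List ℕ → Subset
⋂ V [] = U
⋂ V (i ∷ F) = V i ∩ ⋂ V F

Infinite : Subset → Set
Infinite X = ∀ m → ∃ λ n → m ≤ n × X n

_∈~_ : Subset → Seq → Set
X ∈~ V = ∃ λ (F : List ℕ) → ⋂ V F ⊆ X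

FIP : Seq → Set
FIP V = ∀ (F : List ℕ) → Infinite (⋂ V F)

_∈~_⊕_ : Subset → Seq → Seq → Set₁
X ∈~ V ⊕ W = Σ Subset λ Y → Y ∈~ W × (∀ n → Y n → (X ⊖ n) ∈~ V)

IsSemigroup : Seq → Set₁
IsSemigroup V = FIP V × (∀ i → V i ∈~ V ⊕ V)

_∪｛_｝ : Seq → Subset → Seq
(V ∪｛ A ｝) zero = A
(V ∪｛ A ｝) (suc i) = V i

module Submission where

open import Defs
open import Data.Nat using (ℕ; zero; suc; _+_)
open import Data.Nat.Properties using (≤-trans; m≤m+n)
open import Data.Product using (∃; _,_; proj₁; proj₂)
open import Data.List using (List; []; _∷_; _++_; map)
open import Data.Unit using (tt)
open import Relation.Unary using (_⊆_; _∩_; U)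

-- The hypothesis on A says precisely that A ∈~ U + U (witnessed by U_j). A finite
-- intersection of U ∪ {A} contains A ∩ U_G for a finite G, and U + U is closed under finite
-- intersections, so A ∩ U_G ∈~ U + U. Every X ∈~ U + U is infinite: for n in its witness
-- Y ∈~ U, the set X - n ∈~ U is infinite by fip, and X contains its shift by n.

Infinite-mono : {X Y : Subset} → X ⊆ Y → Infinite X → Infinite Y
Infinite-mono X⊆Y inf m with inf m
... | n , m≤n , Xn = n , m≤n , X⊆Y Xn

Infinite-⊖ : {X : Subset} (n : ℕ) → Infinite (X ⊖ n) → Infinite X
Infinite-⊖ n inf m with inf m
... | k , m≤k , Xk+n = k + n , ≤-trans m≤k (m≤m+n k n) , Xk+n

⋂-++⁻ : (V : Seq) (F G : List ℕ) → ⋂ V (F ++ G) ⊆ ⋂ V F ∩ ⋂ V G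
⋂-++⁻ V []      G p       = tt , p
⋂-++⁻ V (i ∷ F) G (a , p) with ⋂-++⁻ V F G p
... | q , r = (a , q) , r

member-∈~ : (V : Seq) (i : ℕ) → V i ∈~ V
member-∈~ V i = i ∷ [] , proj₁

∈~-∩ : {V : Seq} {X Z : Subset} → X ∈~ V → Z ∈~ V → (X ∩ Z) ∈~ V
∈~-∩ {V} (F , F⊆X) (G , G⊆Z) =
  F ++ G , λ p → F⊆X (proj₁ (⋂-++⁻ V F G p)) , G⊆Z (proj₂ (⋂-++⁻ V F G p))

∈~-infinite : {V : Seq} {X : Subset} → FIP V → X ∈~ V → Infinite X
∈~-infinite fip (F , F⊆X) = Infinite-mono F⊆X (fip F)

∈~-nonempty : {V : Seq} {X : Subset} → FIP V → X ∈~ V → ∃ X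
∈~-nonempty fip X∈~V with ∈~-infinite fip X∈~V 0
... | n , _ , Xn = n , Xn

U-∈~⊕ : {V W : Seq} → U ∈~ V ⊕ W
U-∈~⊕ = U , ([] , λ p → p) , λ _ _ → [] , λ _ → tt

∩-∈~⊕ : {V W : Seq} {X Z : Subset} → X ∈~ V ⊕ W → Z ∈~ V ⊕ W → (X ∩ Z) ∈~ V ⊕ W
∩-∈~⊕ (Y₁ , Y₁∈~W , shiftX) (Y₂ , Y₂∈~W , shiftZ) =
  Y₁ ∩ Y₂ , ∈~-∩ Y₁∈~W Y₂∈~W , λ n p → ∈~-∩ (shiftX n (proj₁ p)) (shiftZ n (proj₂ p))

⋂-∈~⊕ : {V W W′ : Seq} → (∀ i → V i ∈~ W ⊕ W′) → ∀ F → ⋂ V F ∈~ W ⊕ W′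
⋂-∈~⊕     members []      = U-∈~⊕
⋂-∈~⊕ {V} members (i ∷ F) = ∩-∈~⊕ {X = V i} {Z = ⋂ V F} (members i) (⋂-∈~⊕ members F)

∈~⊕-infinite : {V W : Seq} {X : Subset} → FIP V → FIP W → X ∈~ V ⊕ W → Infinite X
∈~⊕-infinite fipV fipW (Y , Y∈~W , shift) with ∈~-nonempty fipW Y∈~W
... | n , Yn = Infinite-⊖ n (∈~-infinite fipV (shift n Yn))

⋂-map-suc : (V : Seq) (A : Subset) (F : List ℕ) → ⋂ (V ∪｛ A ｝) (map suc F) ⊆ ⋂ V F
⋂-map-suc V A []      p       = p
⋂-map-suc V A (i ∷ F) (a , p) = a , ⋂-map-suc V A F p

∈~-∪｛｝ : {V : Seq} {A X : Subset} → X ∈~ V → X ∈~ (V ∪｛ A ｝)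
∈~-∪｛｝ {V} {A} (F , F⊆X) = map suc F , λ p → F⊆X (⋂-map-suc V A F p)

∈~⊕-∪｛｝ : {V W : Seq} {A B X : Subset} → X ∈~ V ⊕ W → X ∈~ (V ∪｛ A ｝) ⊕ (W ∪｛ B ｝)
∈~⊕-∪｛｝ (Y , Y∈~W , shift) = Y , ∈~-∪｛｝ Y∈~W , λ n Yn → ∈~-∪｛｝ (shift n Yn)

indicesOfBase : List ℕ → List ℕ
indicesOfBase []          = []
indicesOfBase (zero  ∷ F) = indicesOfBase F
indicesOfBase (suc i ∷ F) = i ∷ indicesOfBase F

∩-⋂-⊆-⋂-∪｛｝ : (V : Seq) (A : Subset) (F : List ℕ) →
  A ∩ ⋂ V (indicesOfBase F) ⊆ ⋂ (V ∪｛ A ｝) F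
∩-⋂-⊆-⋂-∪｛｝ V A []          _             = tt
∩-⋂-⊆-⋂-∪｛｝ V A (zero  ∷ F) (a , p)       = a , ∩-⋂-⊆-⋂-∪｛｝ V A F (a , p)
∩-⋂-⊆-⋂-∪｛｝ V A (suc i ∷ F) (a , (v , p)) = v , ∩-⋂-⊆-⋂-∪｛｝ V A F (a , p)

lemma3p3 : (U : Seq) (A : Subset) → IsSemigroup U →
    (∃ λ (j : ℕ) → ∀ n → U j n → (A ⊖ n) ∈~ U) →
    IsSemigroup (U ∪｛ A ｝)
lemma3p3 U A (fip , semigroup) (j , shiftA) = fip′ , semigroup′
  where
  A∈~U⊕U : A ∈~ U ⊕ U
  A∈~U⊕U = U j , member-∈~ U j , shiftA

  fip′ : FIP (U ∪｛ A ｝)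
  fip′ F = Infinite-mono (∩-⋂-⊆-⋂-∪｛｝ U A F) (∈~⊕-infinite fip fip A∩U_G∈~U⊕U)
    where
    G = indicesOfBase F
    A∩U_G∈~U⊕U : (A ∩ ⋂ U G) ∈~ U ⊕ U
    A∩U_G∈~U⊕U = ∩-∈~⊕ {X = A} {Z = ⋂ U G} A∈~U⊕U (⋂-∈~⊕ semigroup G)

  semigroup′ : ∀ i → (U ∪｛ A ｝) i ∈~ (U ∪｛ A ｝) ⊕ (U ∪｛ A ｝)
  semigroup′ zero    = ∈~⊕-∪｛｝ {X = A} A∈~U⊕U
  semigroup′ (suc i) = ∈~⊕-∪｛｝ {X = U i} (semigroup i)
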